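{- Let $n \ge 4$ be an integer and let $M^{(n)}$ be the $n\times n$ real matrix with entries $$M^{(n)}_{ij} = \begin{cases} 1, & \text{if } -2 \le j-i \le 1,\\ 1, & \text{if } (i,j)=(1,n-1) \text{ or } (i,j)=(2,n),\\ 0, & \text{otherwise},\end{cases}$$ and let $M_n=\det M^{(n)}$. Then $$M_n=\begin{cases} 0, & n\equiv 0 \pmod 4,\\ 2, & n\equiv 1 \pmod 4,\\ 3, & n\equiv 2 \pmod 4,\\ 1, & n\equiv 3 \pmod 4.\end{cases}$$
   Context: $M^{(n)}$ is the Toeplitz matrix whose first superdiagonal, main diagonal and first two subdiagonals consist of ones, with additional ones at positions $(1,n-1)$ and $(2,n)$ (so the entry $(1,n)$ is $0$), and zeros elsewhere. -}

module Defs where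

open import Data.Nat using (ℕ; zero; suc; _+_; _≤ᵇ_; _≡ᵇ_)
open import Data.Fin using (Fin; toℕ; punchIn)
import Data.Fin as F
open import Data.Bool using (Bool; true; false; if_then_else_; _∧_; _∨_)
open import Data.Integer using (ℤ; 0ℤ; 1ℤ; -1ℤ; _*_) renaming (_+_ to _+ℤ_)

Matrix : ℕ → Set
Matrix n = Fin n → Fin n → ℤ

sumFin : ∀ {n} → (Fin n → ℤ) → ℤ
sumFin {zero}  f = 0ℤ
sumFin {suc n} f = f F.zero +ℤ sumFin (λ i → f (F.suc i))

sgn : ℕ → ℤ
sgn zero = 1ℤ
sgn (suc k) = -1ℤ * sgn k

minor : ∀ {n} → Matrix (suc n) → Fin (suc n) → Matrix n
minor M j i k = M (F.suc i) (punchIn j k)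

det : ∀ n → Matrix n → ℤ
det zero    M = 1ℤ
det (suc n) M = sumFin (λ j → sgn (toℕ j) * (M F.zero j * det n (minor M j)))

-- With 1-based indices i' = toℕ i + 1, j' = toℕ j + 1:
-- entry 1 iff -2 ≤ j'-i' ≤ 1, or (i',j') = (1,n-1), or (i',j') = (2,n).
-- In 0-based indices: i ≤ j+2 and j ≤ i+1, or (i,j) = (0,n-2), or (i,j) = (1,n-1).
Mmat : ∀ n → Matrix n
Mmat n i j =
  if ((toℕ i ≤ᵇ toℕ j + 2) ∧ (toℕ j ≤ᵇ toℕ i + 1))
     ∨ ((toℕ i ≡ᵇ 0) ∧ (toℕ j + 2 ≡ᵇ n))
     ∨ ((toℕ i ≡ᵇ 1) ∧ (toℕ j + 1 ≡ᵇ n))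
  then 1ℤ else 0ℤ

-- Expanding det M⁽ⁿ⁾ along its first two rows leaves minors of the band rows 2, 3, … (whose
-- ones sit in columns r - 2, …, r + 1) on a few columns below 4 followed by the run 4, 5, …,
-- possibly with a gap just before the last column. Expanding such a minor along its first row
-- and shifting every index down by one expresses each family of these minors through the same
-- family one size smaller, by (A, B, C) ↦ (A - B, A - C, A) and (P, Q, R) ↦ (P - Q + R, P, Q);
-- both maps have order 4. So det M⁽ⁿ⁾ is 4-periodic for n ≥ 6, and the small cases are computed.
module Submission where

open import Defs
open import Data.Nat using (ℕ; _≤_; _%_)
open import Data.Integer using (ℤ; +_)
open import Data.Product using (_×_)
open import Relation.Binary.PropositionalEquality using (_≡_)

open import Data.Bool using (true; false; if_then_else_; _∧_; _∨_)
open import Data.Bool.Properties using (∨-identityʳ; ∧-identityʳ)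
open import Data.Fin using (Fin; zero; suc; toℕ; punchIn; inject₁; fromℕ)
open import Data.Fin.Properties
  using (suc-injective; toℕ-injective; toℕ-fromℕ; toℕ-inject₁; toℕ<n; inject₁-lower₁)
open import Data.Integer using (0ℤ; 1ℤ; -1ℤ; _*_; _-_; -_) renaming (_+_ to _+ℤ_)
open import Data.Integer.Properties
  using (+-identityˡ; +-identityʳ; *-identityˡ; *-zeroʳ; *-assoc; *-distribˡ-+; -1*i≡-i; neg-involutive)
open import Data.Nat as ℕ using (zero; suc; _+_; _≤ᵇ_; _≡ᵇ_; s≤s)
open import Data.Nat.DivMod using ([m+n]%n≡m%n)
open import Data.Nat.GeneralisedArithmetic using (fold)
import Data.Nat.Properties as ℕ
open import Data.Product using (_,_)
open import Data.Vec using (Vec; []; _∷_; lookup; removeAt; map; _++_)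
open import Data.Vec.Properties using (lookup-map; map-++)
open import Data.Vec.Relation.Unary.All as All using (All; []; _∷_)
open import Data.Vec.Relation.Unary.All.Properties using (lookup⁺)
open import Function using (id; _∘_)
open import Relation.Binary.PropositionalEquality
  using (refl; sym; trans; cong; cong₂; _≢_; module ≡-Reasoning)
open import Relation.Nullary using (contradiction)

private variable
  a m p q : ℕ

sumFin-cong : {g h : Fin p → ℤ} → (∀ j → g j ≡ h j) → sumFin g ≡ sumFin h
sumFin-cong {zero}  e = refl
sumFin-cong {suc p} e = cong₂ _+ℤ_ (e zero) (sumFin-cong (e ∘ suc))

sumFin-zero : {g : Fin p → ℤ} → (∀ j → g j ≡ 0ℤ) → sumFin g ≡ 0ℤ
sumFin-zero {zero}  e = refl
sumFin-zero {suc p} e = cong₂ _+ℤ_ (e zero) (sumFin-zero (e ∘ suc))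

sumFin-single : {g : Fin p → ℤ} (i : Fin p) → (∀ j → j ≢ i → g j ≡ 0ℤ) → sumFin g ≡ g i
sumFin-single {g = g} zero e =
  trans (cong (g zero +ℤ_) (sumFin-zero λ j → e (suc j) λ ())) (+-identityʳ (g zero))
sumFin-single (suc i) e =
  trans (cong₂ _+ℤ_ (e zero λ ()) (sumFin-single i λ j j≢i → e (suc j) (j≢i ∘ suc-injective)))
        (+-identityˡ _)

sumFin-*ˡ : ∀ x (g : Fin p → ℤ) → sumFin (λ j → x * g j) ≡ x * sumFin g
sumFin-*ˡ {zero}  x g = sym (*-zeroʳ x)
sumFin-*ˡ {suc p} x g =
  trans (cong (x * g zero +ℤ_) (sumFin-*ˡ x (g ∘ suc))) (sym (*-distribˡ-+ x (g zero) _))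

det-ext : ∀ n {A B : Matrix n} → (∀ i j → A i j ≡ B i j) → det n A ≡ det n B
det-ext zero    e = refl
det-ext (suc n) e = sumFin-cong λ j →
  cong₂ (λ x d → sgn (toℕ j) * (x * d)) (e zero j) (det-ext n λ i k → e (suc i) (punchIn j k))

term-zero-entry : ∀ s {x} d → x ≡ 0ℤ → s * (x * d) ≡ 0ℤ
term-zero-entry s d refl = *-zeroʳ s

term-zero-minor : ∀ s x {d} → d ≡ 0ℤ → s * (x * d) ≡ 0ℤ
term-zero-minor s x refl = trans (cong (s *_) (*-zeroʳ x)) (*-zeroʳ s)

det-zero-column : (A : Matrix (suc p)) → (∀ i → A i zero ≡ 0ℤ) → det (suc p) A ≡ 0ℤ
det-zero-column {zero}  A e = cong (λ x → 1ℤ * (x * 1ℤ) +ℤ 0ℤ) (e zero)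
det-zero-column {suc p} A e =
  sumFin-zero {g = λ j → sgn (toℕ j) * (A zero j * det (suc p) (minor A j))} λ where
    zero    → term-zero-entry 1ℤ _ (e zero)
    (suc j) → term-zero-minor (sgn (toℕ (suc j))) (A zero (suc j))
                              (det-zero-column (minor A (suc j)) (e ∘ suc))

lookup-removeAt : ∀ {A : Set} (xs : Vec A (suc p)) i j →
  lookup (removeAt xs i) j ≡ lookup xs (punchIn i j)
lookup-removeAt (x ∷ xs)     zero    j       = refl
lookup-removeAt (x ∷ y ∷ xs) (suc i) zero    = refl
lookup-removeAt (x ∷ y ∷ xs) (suc i) (suc j) = lookup-removeAt (y ∷ xs) i j

-- The minor of the ℕ-indexed matrix f on its first p rows and the columns cs. It is opaque
-- because Agda would otherwise unfold det whenever two minors are compared.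
opaque
  subdet : (ℕ → ℕ → ℤ) → Vec ℕ p → ℤ
  subdet {p} f cs = det p λ i j → f (toℕ i) (lookup cs j)

  det-subdet : ∀ {n} (A : Matrix n) f (cs : Vec ℕ n) →
    (∀ i j → A i j ≡ f (toℕ i) (lookup cs j)) → det n A ≡ subdet f cs
  det-subdet A f cs = det-ext _

  subdet-ext : {f g : ℕ → ℕ → ℤ} → (∀ i c → f i c ≡ g i c) → (cs : Vec ℕ p) →
    subdet f cs ≡ subdet g cs
  subdet-ext e cs = det-ext _ λ i j → e (toℕ i) (lookup cs j)

  subdet-map : ∀ f (h : ℕ → ℕ) (cs : Vec ℕ p) →
    subdet f (map h cs) ≡ subdet (λ i c → f i (h c)) cs
  subdet-map f h cs = det-ext _ λ i j → cong (f (toℕ i)) (lookup-map j h cs)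

  subdet-zero-column : ∀ {f c} → (∀ i → f i c ≡ 0ℤ) → (cs : Vec ℕ p) →
    subdet f (c ∷ cs) ≡ 0ℤ
  subdet-zero-column {f = f} {c} e cs =
    det-zero-column (λ i j → f (toℕ i) (lookup (c ∷ cs) j)) (e ∘ toℕ)

  subdet-laplace : ∀ f (cs : Vec ℕ (suc p)) →
    subdet f cs ≡ sumFin λ j → sgn (toℕ j) * (f 0 (lookup cs j) * subdet (f ∘ suc) (removeAt cs j))
  subdet-laplace f cs = sumFin-cong λ j →
    cong (λ d → sgn (toℕ j) * (f 0 (lookup cs j) * d))
         (det-ext _ λ i k → cong (f (suc (toℕ i))) (sym (lookup-removeAt cs j k)))

-- Laplace expansion of subdet f (ctx cs) along its first row, over the columns cs only:
-- ctx puts back the columns that have already been expanded.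
cofactors : (ℕ → ℕ → ℤ) → (Vec ℕ p → Vec ℕ q) → Vec ℕ (suc p) → ℤ
cofactors f ctx cs =
  sumFin λ j → sgn (toℕ j) * (f 0 (lookup cs j) * subdet (f ∘ suc) (ctx (removeAt cs j)))

altSum : (Fin (suc a) → ℤ) → ℤ
altSum {zero}  x = x zero
altSum {suc a} x = x zero - altSum (x ∘ suc)

module _ {f : ℕ → ℕ → ℤ} where

  private
    minor₁ : Vec ℕ q → ℤ
    minor₁ = subdet (f ∘ suc)

    unit-term : ∀ {x} d → x ≡ 1ℤ → 1ℤ * (x * d) ≡ d
    unit-term d refl = trans (*-identityˡ _) (*-identityˡ d)

  cofactors-∷ : ∀ {c d} {cs : Vec ℕ p} {ctx : Vec ℕ (suc p) → Vec ℕ q} → f 0 c ≡ 1ℤ →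
    cofactors f ctx (c ∷ d ∷ cs) ≡ minor₁ (ctx (d ∷ cs)) - cofactors f (ctx ∘ (c ∷_)) (d ∷ cs)
  cofactors-∷ {p = p} {c = c} {d} {cs} {ctx} one = cong₂ _+ℤ_ (unit-term _ one) (begin
    sumFin (λ j → (-1ℤ * sgn (toℕ j)) * term j)
      ≡⟨ sumFin-cong (λ j → *-assoc -1ℤ (sgn (toℕ j)) (term j)) ⟩
    sumFin (λ j → -1ℤ * (sgn (toℕ j) * term j))
      ≡⟨ sumFin-*ˡ -1ℤ (λ j → sgn (toℕ j) * term j) ⟩
    -1ℤ * cofactors f (ctx ∘ (c ∷_)) (d ∷ cs)
      ≡⟨ -1*i≡-i _ ⟩
    - cofactors f (ctx ∘ (c ∷_)) (d ∷ cs) ∎)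
    where
    open ≡-Reasoning
    term : Fin (suc p) → ℤ
    term j = f 0 (lookup (d ∷ cs) j) * minor₁ (ctx (c ∷ removeAt (d ∷ cs) j))

  cofactors-zero : ∀ {cs : Vec ℕ (suc p)} {ctx : Vec ℕ p → Vec ℕ q} →
    (∀ j → f 0 (lookup cs j) ≡ 0ℤ) → cofactors f ctx cs ≡ 0ℤ
  cofactors-zero {cs = cs} {ctx} zeros = sumFin-zero λ j →
    term-zero-entry (sgn (toℕ j)) (minor₁ (ctx (removeAt cs j))) (zeros j)

  cofactors-single : ∀ {cs : Vec ℕ (suc p)} {ctx : Vec ℕ p → Vec ℕ q} i →
    f 0 (lookup cs i) ≡ 1ℤ → (∀ j → j ≢ i → f 0 (lookup cs j) ≡ 0ℤ) →
    cofactors f ctx cs ≡ sgn (toℕ i) * minor₁ (ctx (removeAt cs i))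
  cofactors-single {cs = cs} {ctx} i one zeros =
    trans (sumFin-single i λ j j≢i →
             term-zero-entry (sgn (toℕ j)) (minor₁ (ctx (removeAt cs j))) (zeros j j≢i))
          (cong (sgn (toℕ i) *_) (trans (cong (_* minor₁ (ctx (removeAt cs i))) one) (*-identityˡ _)))

  cofactors-last : ∀ {cs : Vec ℕ (suc p)} {ctx : Vec ℕ p → Vec ℕ q} →
    f 0 (lookup cs (fromℕ p)) ≡ 1ℤ → (∀ j → f 0 (lookup cs (inject₁ j)) ≡ 0ℤ) →
    cofactors f ctx cs ≡ sgn p * minor₁ (ctx (removeAt cs (fromℕ p)))
  cofactors-last {p = p} {cs = cs} {ctx} one zeros =
    trans (cofactors-single {cs = cs} {ctx} (fromℕ p) one λ j j≢last →
             let p≢j = λ p≡j → j≢last (toℕ-injective (trans (sym p≡j) (sym (toℕ-fromℕ p))))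
             in  trans (cong (f 0 ∘ lookup cs) (sym (inject₁-lower₁ j p≢j))) (zeros _))
          (cong (λ t → sgn t * minor₁ (ctx (removeAt cs (fromℕ p)))) (toℕ-fromℕ p))

  cofactors-ones++zeros : ∀ (w : Vec ℕ (suc a)) {t : Vec ℕ m} {ctx : Vec ℕ (a + m) → Vec ℕ q} →
    All (λ c → f 0 c ≡ 1ℤ) w → All (λ c → f 0 c ≡ 0ℤ) t →
    cofactors f ctx (w ++ t) ≡ altSum λ j → minor₁ (ctx (removeAt w j ++ t))
  cofactors-ones++zeros (_ ∷ [])     {[]}    {ctx} (one ∷ []) _ =
    trans (+-identityʳ _) (unit-term (minor₁ (ctx [])) one)
  cofactors-ones++zeros (c ∷ [])     {d ∷ t} {ctx} (one ∷ []) zeros =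
    trans (cofactors-∷ {cs = t} {ctx} one)
          (trans (cong (_-_ (minor₁ (ctx (d ∷ t))))
                       (cofactors-zero {cs = d ∷ t} {ctx ∘ (c ∷_)} (lookup⁺ zeros)))
                 (+-identityʳ _))
  cofactors-ones++zeros (c ∷ c′ ∷ w) {t}     {ctx} (one ∷ ones) zeros =
    trans (cofactors-∷ {cs = w ++ t} {ctx} one)
          (cong (_-_ (minor₁ (ctx (c′ ∷ w ++ t))))
                (cofactors-ones++zeros (c′ ∷ w) {ctx = ctx ∘ (c ∷_)} ones zeros))

subdet-ones++zeros : ∀ f (w : Vec ℕ (suc a)) {t : Vec ℕ m} →
  All (λ c → f 0 c ≡ 1ℤ) w → All (λ c → f 0 c ≡ 0ℤ) t →
  subdet f (w ++ t) ≡ altSum λ j → subdet (f ∘ suc) (removeAt w j ++ t)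
subdet-ones++zeros f w {t} ones zeros =
  trans (subdet-laplace f (w ++ t)) (cofactors-ones++zeros {f = f} w {ctx = id} ones zeros)

ladder : ℕ → ℕ → (k : ℕ) → Vec ℕ (suc k)
ladder s x zero    = x ∷ []
ladder s x (suc k) = s ∷ ladder (suc s) (suc x) k

map-suc-ladder : ∀ s x k → map suc (ladder s x k) ≡ ladder (suc s) (suc x) k
map-suc-ladder s x zero    = refl
map-suc-ladder s x (suc k) = cong (suc s ∷_) (map-suc-ladder (suc s) (suc x) k)

lookup-ladder : ∀ s k j → lookup (ladder s s k) j ≡ s + toℕ j
lookup-ladder s zero    zero    = sym (ℕ.+-identityʳ s)
lookup-ladder s (suc k) zero    = sym (ℕ.+-identityʳ s)
lookup-ladder s (suc k) (suc j) = trans (lookup-ladder (suc s) k j) (sym (ℕ.+-suc s (toℕ j)))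

lookup-ladder-inject₁ : ∀ s x k j → lookup (ladder s x k) (inject₁ j) ≡ s + toℕ j
lookup-ladder-inject₁ s x (suc k) zero    = sym (ℕ.+-identityʳ s)
lookup-ladder-inject₁ s x (suc k) (suc j) =
  trans (lookup-ladder-inject₁ (suc s) (suc x) k j) (sym (ℕ.+-suc s (toℕ j)))

lookup-ladder-last : ∀ s x k → lookup (ladder s x k) (fromℕ k) ≡ x + k
lookup-ladder-last s x zero    = sym (ℕ.+-identityʳ x)
lookup-ladder-last s x (suc k) = trans (lookup-ladder-last (suc s) (suc x) k) (sym (ℕ.+-suc x k))

removeAt-ladder-last : ∀ s x k → removeAt (ladder s x (suc k)) (fromℕ (suc k)) ≡ ladder s s k
removeAt-ladder-last s x zero    = refl
removeAt-ladder-last s x (suc k) = cong (s ∷_) (removeAt-ladder-last (suc s) (suc x) k)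

removeAt-ladder-penultimate : ∀ s x k →
  removeAt (ladder s x (suc k)) (inject₁ (fromℕ k)) ≡ ladder s (suc x) k
removeAt-ladder-penultimate s x zero    = refl
removeAt-ladder-penultimate s x (suc k) = cong (s ∷_) (removeAt-ladder-penultimate (suc s) (suc x) k)

ladder-≥ : ∀ {s x} k → s ≤ x → All (s ≤_) (ladder s x k)
ladder-≥ zero    s≤x = s≤x ∷ []
ladder-≥ (suc k) s≤x = ℕ.≤-refl ∷ All.map ℕ.<⇒≤ (ladder-≥ k (s≤s s≤x))

-- band r c = 1 exactly when r - 2 ≤ c ≤ r + 1; rows 2, 3, … of M⁽ⁿ⁾ are rows of band.
band : ℕ → ℕ → ℤ
band zero    c       = if c ≤ᵇ 1 then 1ℤ else 0ℤ
band (suc r) zero    = if r ≤ᵇ 1 then 1ℤ else 0ℤ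
band (suc r) (suc c) = band r c

band-beyond : ∀ {c} → 4 ≤ c → band 2 c ≡ 0ℤ
band-beyond (s≤s (s≤s (s≤s (s≤s _)))) = refl

bandMinor : ℕ → Vec ℕ p → ℤ
bandMinor r = subdet λ i → band (r + i)

bandMinor-map-suc : ∀ r (cs : Vec ℕ p) → bandMinor (suc r) (map suc cs) ≡ bandMinor r cs
bandMinor-map-suc r = subdet-map (λ i → band (suc r + i)) suc

bandMinor-zero-column : (cs : Vec ℕ p) → bandMinor 3 (0 ∷ cs) ≡ 0ℤ
bandMinor-zero-column = subdet-zero-column {f = λ i → band (3 + i)} {0} λ _ → refl

bandMinor-expand : ∀ (w : Vec ℕ (suc a)) {t : Vec ℕ m} →
  All (λ c → band 2 c ≡ 1ℤ) w → All (4 ≤_) t →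
  bandMinor 2 (w ++ t) ≡ altSum λ j → bandMinor 3 (removeAt w j ++ t)
bandMinor-expand w ones beyond =
  subdet-ones++zeros (λ i → band (2 + i)) w ones (All.map band-beyond beyond)

bandMinor-ladder : ∀ r (w : Vec ℕ a) s x k →
  bandMinor (suc r) (map suc w ++ ladder (suc s) (suc x) k) ≡ bandMinor r (w ++ ladder s x k)
bandMinor-ladder r w s x k = begin
  bandMinor (suc r) (map suc w ++ ladder (suc s) (suc x) k)
    ≡⟨ cong (λ t → bandMinor (suc r) (map suc w ++ t)) (sym (map-suc-ladder s x k)) ⟩
  bandMinor (suc r) (map suc w ++ map suc (ladder s x k))
    ≡⟨ cong (bandMinor (suc r)) (sym (map-++ suc w (ladder s x k))) ⟩
  bandMinor (suc r) (map suc (w ++ ladder s x k))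
    ≡⟨ bandMinor-map-suc r (w ++ ladder s x k) ⟩
  bandMinor r (w ++ ladder s x k) ∎
  where open ≡-Reasoning

windowMinor : Vec ℕ a → ℕ → ℕ → ℤ
windowMinor w x p = bandMinor 2 (w ++ ladder 4 x p)

Triple : Set
Triple = ℤ × ℤ × ℤ

abc : ℕ → ℕ → Triple
abc x p =
  windowMinor (2 ∷ 3 ∷ []) x p , windowMinor (1 ∷ 3 ∷ []) x p , windowMinor (0 ∷ 3 ∷ []) x p

pqr : ℕ → ℕ → Triple
pqr x p =
  windowMinor (1 ∷ 2 ∷ 3 ∷ []) x p ,
  windowMinor (0 ∷ 2 ∷ 3 ∷ []) x p ,
  windowMinor (0 ∷ 1 ∷ 3 ∷ []) x p

abc-step : Triple → Triple
abc-step (a , b , c) = a - b , a - c , a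

pqr-step : Triple → Triple
pqr-step (p , q , r) = p - (q - r) , p , q

module _ {x : ℕ} (4≤x : 4 ≤ x) (p : ℕ) where

  private
    expand : ∀ (w : Vec ℕ (suc a)) → All (λ c → band 2 c ≡ 1ℤ) w →
      windowMinor w x (suc p) ≡ altSum λ j → bandMinor 3 (removeAt w j ++ ladder 4 x (suc p))
    expand w ones = bandMinor-expand w ones (ladder-≥ (suc p) 4≤x)

    shift : ∀ (w : Vec ℕ a) → bandMinor 3 (map suc w ++ ladder 5 (suc x) p) ≡ windowMinor w x p
    shift w = bandMinor-ladder 2 w 4 x p

    dead : (cs : Vec ℕ q) → bandMinor 3 (0 ∷ cs) ≡ 0ℤ
    dead = bandMinor-zero-column

    L : Vec ℕ (suc p)
    L = ladder 5 (suc x) p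

  -- Column 0 meets rows 3, 4, … only in zeros, so every minor still containing it vanishes.
  abc-suc : abc x (suc p) ≡ abc-step (abc x p)
  abc-suc = cong₂ _,_
    (trans (expand (2 ∷ 3 ∷ []) (refl ∷ refl ∷ []))
           (cong₂ _-_ (shift (2 ∷ 3 ∷ [])) (shift (1 ∷ 3 ∷ []))))
    (cong₂ _,_
      (trans (expand (1 ∷ 3 ∷ []) (refl ∷ refl ∷ []))
             (cong₂ _-_ (shift (2 ∷ 3 ∷ [])) (shift (0 ∷ 3 ∷ []))))
      (trans (expand (0 ∷ 3 ∷ []) (refl ∷ refl ∷ []))
             (trans (cong₂ _-_ (shift (2 ∷ 3 ∷ [])) (dead (4 ∷ L))) (+-identityʳ _))))

  pqr-suc : pqr x (suc p) ≡ pqr-step (pqr x p)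
  pqr-suc = cong₂ _,_
    (trans (expand (1 ∷ 2 ∷ 3 ∷ []) (refl ∷ refl ∷ refl ∷ []))
           (cong₂ _-_ (shift (1 ∷ 2 ∷ 3 ∷ []))
                      (cong₂ _-_ (shift (0 ∷ 2 ∷ 3 ∷ [])) (shift (0 ∷ 1 ∷ 3 ∷ [])))))
    (cong₂ _,_
      (trans (expand (0 ∷ 2 ∷ 3 ∷ []) (refl ∷ refl ∷ refl ∷ []))
             (trans (cong₂ _-_ (shift (1 ∷ 2 ∷ 3 ∷ []))
                               (cong₂ _-_ (dead (3 ∷ 4 ∷ L)) (dead (2 ∷ 4 ∷ L))))
                    (+-identityʳ _)))
      (trans (expand (0 ∷ 1 ∷ 3 ∷ []) (refl ∷ refl ∷ refl ∷ []))
             (trans (cong₂ _-_ (shift (0 ∷ 2 ∷ 3 ∷ []))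
                               (cong₂ _-_ (dead (3 ∷ 4 ∷ L)) (dead (1 ∷ 4 ∷ L))))
                    (+-identityʳ _))))

-- det M⁽⁶⁺ᵏ⁾ as produced by expanding its first two rows, applied to abc 4 (1 + k), pqr 4 k,
-- pqr 5 k and τ = sgn (1 + k).
topExpansion : Triple → Triple → Triple → ℤ → ℤ
topExpansion (a , b , c) (p , q , r) (p′ , q′ , r′) τ =
  (a - (b - σ * p)) - ((a - (c - σ * q)) - σ * (p′ - (q′ - (r′ - τ * 1ℤ))))
  where
  σ : ℤ
  σ = -1ℤ * τ

detFormula : ℕ → ℤ
detFormula k = topExpansion (abc 4 (1 + k)) (pqr 4 k) (pqr 5 k) (sgn (1 + k))

residueValue : ℕ → ℤ
residueValue 0 = + 0
residueValue 1 = + 2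
residueValue 2 = + 3
residueValue _ = + 1

opaque
  unfolding subdet

  unitriangularMinor-base : bandMinor 2 (0 ∷ 1 ∷ 2 ∷ 3 ∷ []) ≡ 1ℤ
  unitriangularMinor-base = refl

  abc-orbit : fold (abc 4 0) abc-step 4 ≡ abc 4 0
  abc-orbit = refl

  pqr₄-orbit : fold (pqr 4 0) pqr-step 4 ≡ pqr 4 0
  pqr₄-orbit = refl

  pqr₅-orbit : fold (pqr 5 0) pqr-step 4 ≡ pqr 5 0
  pqr₅-orbit = refl

  detFormula-initial : (i : Fin 4) → detFormula (toℕ i) ≡ residueValue ((6 + toℕ i) % 4)
  detFormula-initial zero                   = refl
  detFormula-initial (suc zero)             = refl
  detFormula-initial (suc (suc zero))       = refl
  detFormula-initial (suc (suc (suc zero))) = refl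

unitriangularMinor : ∀ p → bandMinor 2 (0 ∷ 1 ∷ 2 ∷ ladder 3 3 p) ≡ 1ℤ
unitriangularMinor zero    = unitriangularMinor-base
unitriangularMinor (suc p) = begin
  bandMinor 2 ((0 ∷ 1 ∷ 2 ∷ 3 ∷ []) ++ ladder 4 4 p)
    ≡⟨ bandMinor-expand (0 ∷ 1 ∷ 2 ∷ 3 ∷ []) (refl ∷ refl ∷ refl ∷ refl ∷ [])
                        (ladder-≥ p ℕ.≤-refl) ⟩
  bandMinor 3 (1 ∷ 2 ∷ 3 ∷ ladder 4 4 p) - (bandMinor 3 (0 ∷ 2 ∷ 3 ∷ ladder 4 4 p)
    - (bandMinor 3 (0 ∷ 1 ∷ 3 ∷ ladder 4 4 p) - bandMinor 3 (0 ∷ 1 ∷ 2 ∷ ladder 4 4 p)))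
    ≡⟨ cong₂ _-_ (bandMinor-ladder 2 (0 ∷ 1 ∷ 2 ∷ []) 3 3 p)
                 (cong₂ _-_ (dead (2 ∷ 3 ∷ L))
                            (cong₂ _-_ (dead (1 ∷ 3 ∷ L)) (dead (1 ∷ 2 ∷ L)))) ⟩
  bandMinor 2 (0 ∷ 1 ∷ 2 ∷ ladder 3 3 p) - 0ℤ
    ≡⟨ +-identityʳ _ ⟩
  bandMinor 2 (0 ∷ 1 ∷ 2 ∷ ladder 3 3 p)
    ≡⟨ unitriangularMinor p ⟩
  1ℤ ∎
  where
  open ≡-Reasoning
  dead : (cs : Vec ℕ q) → bandMinor 3 (0 ∷ cs) ≡ 0ℤ
  dead = bandMinor-zero-column
  L : Vec ℕ (suc p)
  L = ladder 4 4 p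

recurrence-periodic : ∀ {X : Set} (T : X → X) (F : ℕ → X) → (∀ p → F (suc p) ≡ T (F p)) →
  ∀ m → fold (F 0) T m ≡ F 0 → ∀ p → F (m + p) ≡ F p
recurrence-periodic T F step m period = go
  where
  unfold : ∀ i p → F (i + p) ≡ fold (F p) T i
  unfold zero    p = refl
  unfold (suc i) p = trans (step (i + p)) (cong T (unfold i p))

  fold-step : ∀ y i → fold (T y) T i ≡ T (fold y T i)
  fold-step y zero    = refl
  fold-step y (suc i) = cong T (fold-step y i)

  go : ∀ p → F (m + p) ≡ F p
  go zero    = trans (unfold m 0) period
  go (suc p) = begin
    F (m + suc p)          ≡⟨ unfold m (suc p) ⟩
    fold (F (suc p)) T m   ≡⟨ cong (λ y → fold y T m) (step p) ⟩
    fold (T (F p)) T m     ≡⟨ fold-step (F p) m ⟩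
    T (fold (F p) T m)     ≡⟨ cong T (trans (sym (unfold m p)) (go p)) ⟩
    T (F p)                ≡⟨ sym (step p) ⟩
    F (suc p)              ∎
    where open ≡-Reasoning


M : ℕ → ℕ → ℕ → ℤ
M n i j =
  if ((i ≤ᵇ j + 2) ∧ (j ≤ᵇ i + 1))
     ∨ ((i ≡ᵇ 0) ∧ (j + 2 ≡ᵇ n))
     ∨ ((i ≡ᵇ 1) ∧ (j + 1 ≡ᵇ n))
  then 1ℤ else 0ℤ

det-Mmat : ∀ n (cs : Vec ℕ n) → (∀ j → lookup cs j ≡ toℕ j) →
  det n (Mmat n) ≡ subdet (M n) cs
det-Mmat n cs e = det-subdet (Mmat n) (M n) cs λ i j → cong (M n (toℕ i)) (sym (e j))

suc-≤ᵇ-suc : ∀ m n → (suc m ≤ᵇ suc n) ≡ (m ≤ᵇ n)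
suc-≤ᵇ-suc zero    n = refl
suc-≤ᵇ-suc (suc m) n = refl

band-≤ᵇ : ∀ r c → band r c ≡ (if (r ≤ᵇ c + 2) ∧ (c ≤ᵇ r + 1) then 1ℤ else 0ℤ)
band-≤ᵇ zero    c       = refl
band-≤ᵇ (suc r) zero    =
  cong (λ b → if b then 1ℤ else 0ℤ) (sym (trans (∧-identityʳ _) (suc-≤ᵇ-suc r 1)))
band-≤ᵇ (suc r) (suc c) = trans (band-≤ᵇ r c) (cong (λ b → if b then 1ℤ else 0ℤ)
  (sym (cong₂ _∧_ (suc-≤ᵇ-suc r (c + 2)) (suc-≤ᵇ-suc c (r + 1)))))

M-band : ∀ n r c → M n (2 + r) c ≡ band (2 + r) c
M-band n r c =
  trans (cong (λ b → if b then 1ℤ else 0ℤ) (∨-identityʳ _)) (sym (band-≤ᵇ (2 + r) c))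

δ : ℕ → ℕ → ℤ
δ y z = if y ≡ᵇ z then 1ℤ else 0ℤ

δ-diag : ∀ y → δ y y ≡ 1ℤ
δ-diag zero    = refl
δ-diag (suc y) = δ-diag y

δ-off : ∀ {y z} → y ≢ z → δ y z ≡ 0ℤ
δ-off {y} {z} y≢z with y ≡ᵇ z | ℕ.≡ᵇ⇒≡ y z
... | false | _   = refl
... | true  | y≡z = contradiction (y≡z _) y≢z

≡ᵇ-+ : ∀ c y z → (y + c ≡ᵇ c + z) ≡ (y ≡ᵇ z)
≡ᵇ-+ c y z = trans (cong (_≡ᵇ c + z) (ℕ.+-comm y c)) (cancel c)
  where
  cancel : ∀ c → (c + y ≡ᵇ c + z) ≡ (y ≡ᵇ z)
  cancel zero    = refl
  cancel (suc c) = cancel c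

M-row₀ : ∀ k y → M (6 + k) 0 (2 + y) ≡ δ y (2 + k)
M-row₀ k y = cong (λ b → if b then 1ℤ else 0ℤ) (trans (∨-identityʳ _) (≡ᵇ-+ 2 y (2 + k)))

M-row₁ : ∀ k y → M (6 + k) 1 (3 + y) ≡ δ y (2 + k)
M-row₁ k y = cong (λ b → if b then 1ℤ else 0ℤ) (≡ᵇ-+ 1 y (2 + k))

module _ (k : ℕ) where

  private
    Mₖ : ℕ → ℕ → ℤ
    Mₖ = M (6 + k)

    toBand : (cs : Vec ℕ p) → subdet ((Mₖ ∘ suc) ∘ suc) cs ≡ bandMinor 2 cs
    toBand = subdet-ext (M-band (6 + k))

    cofactors-row₁ : ∀ x m {ctx : Vec ℕ m → Vec ℕ q} → x + m ≡ 5 + k → m ≤ 2 + k →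
      cofactors (Mₖ ∘ suc) ctx (ladder 3 x m)
        ≡ sgn m * subdet ((Mₖ ∘ suc) ∘ suc) (ctx (removeAt (ladder 3 x m) (fromℕ m)))
    cofactors-row₁ x m {ctx} x+m≡ m≤ = cofactors-last {f = Mₖ ∘ suc} {cs = ladder 3 x m} {ctx}
      (trans (cong (Mₖ 1) (trans (lookup-ladder-last 3 x m) x+m≡))
             (trans (M-row₁ k (2 + k)) (δ-diag (2 + k))))
      λ j → trans (cong (Mₖ 1) (lookup-ladder-inject₁ 3 x m j))
                  (trans (M-row₁ k (toℕ j)) (δ-off (ℕ.<⇒≢ (ℕ.<-≤-trans (toℕ<n j) m≤))))

  row₀-expansion : subdet Mₖ (ladder 0 0 (5 + k))
    ≡ subdet (Mₖ ∘ suc) (1 ∷ 2 ∷ ladder 3 3 (2 + k))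
      - (subdet (Mₖ ∘ suc) (0 ∷ 2 ∷ ladder 3 3 (2 + k))
         - sgn (2 + k) * subdet (Mₖ ∘ suc) (0 ∷ 1 ∷ 2 ∷ ladder 3 4 (1 + k)))
  row₀-expansion = begin
    subdet Mₖ (0 ∷ 1 ∷ t)
      ≡⟨ subdet-laplace Mₖ (0 ∷ 1 ∷ t) ⟩
    cofactors Mₖ id (0 ∷ 1 ∷ t)
      ≡⟨ cofactors-∷ {f = Mₖ} {cs = t} {id} refl ⟩
    subdet (Mₖ ∘ suc) (1 ∷ t) - cofactors Mₖ (0 ∷_) (1 ∷ t)
      ≡⟨ cong (_-_ (subdet (Mₖ ∘ suc) (1 ∷ t)))
              (cofactors-∷ {f = Mₖ} {cs = ladder 3 3 (2 + k)} {0 ∷_} refl) ⟩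
    subdet (Mₖ ∘ suc) (1 ∷ t) - (subdet (Mₖ ∘ suc) (0 ∷ t) - cofactors Mₖ (λ v → 0 ∷ 1 ∷ v) t)
      ≡⟨ cong (λ z → subdet (Mₖ ∘ suc) (1 ∷ t) - (subdet (Mₖ ∘ suc) (0 ∷ t) - z)) last-term ⟩
    subdet (Mₖ ∘ suc) (1 ∷ t)
      - (subdet (Mₖ ∘ suc) (0 ∷ t) - sgn (2 + k) * subdet (Mₖ ∘ suc) (0 ∷ 1 ∷ ladder 2 3 (2 + k))) ∎
    where
    open ≡-Reasoning
    t : Vec ℕ (4 + k)
    t = ladder 2 2 (3 + k)

    i : Fin (4 + k)
    i = inject₁ (fromℕ (2 + k))

    toℕ-i : toℕ i ≡ 2 + k
    toℕ-i = trans (toℕ-inject₁ (fromℕ (2 + k))) (toℕ-fromℕ (2 + k))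

    entry : ∀ j → Mₖ 0 (lookup t j) ≡ δ (toℕ j) (2 + k)
    entry j = trans (cong (Mₖ 0) (lookup-ladder 2 (3 + k) j)) (M-row₀ k (toℕ j))

    last-term : cofactors Mₖ (λ v → 0 ∷ 1 ∷ v) t
      ≡ sgn (2 + k) * subdet (Mₖ ∘ suc) (0 ∷ 1 ∷ ladder 2 3 (2 + k))
    last-term = trans
      (cofactors-single {f = Mₖ} {cs = t} {λ v → 0 ∷ 1 ∷ v} i
        (trans (entry i) (trans (cong (λ y → δ y (2 + k)) toℕ-i) (δ-diag (2 + k))))
        λ j j≢i → trans (entry j) (δ-off λ j≡ → j≢i (toℕ-injective (trans j≡ (sym toℕ-i)))))
      (cong₂ (λ e cs → sgn e * subdet (Mₖ ∘ suc) (0 ∷ 1 ∷ cs)) toℕ-i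
             (removeAt-ladder-penultimate 2 2 (2 + k)))

  row₁-expansion : ∀ c → Mₖ 1 c ≡ 1ℤ →
    subdet (Mₖ ∘ suc) (c ∷ 2 ∷ ladder 3 3 (2 + k))
      ≡ bandMinor 2 (2 ∷ ladder 3 3 (2 + k))
        - (bandMinor 2 (c ∷ ladder 3 3 (2 + k)) - sgn (2 + k) * bandMinor 2 (c ∷ 2 ∷ ladder 3 3 (1 + k)))
  row₁-expansion c one = begin
    subdet (Mₖ ∘ suc) (c ∷ 2 ∷ t)
      ≡⟨ subdet-laplace (Mₖ ∘ suc) (c ∷ 2 ∷ t) ⟩
    cofactors (Mₖ ∘ suc) id (c ∷ 2 ∷ t)
      ≡⟨ cofactors-∷ {f = Mₖ ∘ suc} {cs = t} {id} one ⟩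
    S (2 ∷ t) - cofactors (Mₖ ∘ suc) (c ∷_) (2 ∷ t)
      ≡⟨ cong (_-_ (S (2 ∷ t)))
              (cofactors-∷ {f = Mₖ ∘ suc} {cs = ladder 4 4 (1 + k)} {c ∷_} refl) ⟩
    S (2 ∷ t) - (S (c ∷ t) - cofactors (Mₖ ∘ suc) (λ v → c ∷ 2 ∷ v) t)
      ≡⟨ cong (λ z → S (2 ∷ t) - (S (c ∷ t) - z))
              (cofactors-row₁ 3 (2 + k) {λ v → c ∷ 2 ∷ v} refl ℕ.≤-refl) ⟩
    S (2 ∷ t) - (S (c ∷ t) - sgn (2 + k) * S (c ∷ 2 ∷ removeAt t (fromℕ (2 + k))))
      ≡⟨ cong (λ cs → S (2 ∷ t) - (S (c ∷ t) - sgn (2 + k) * S (c ∷ 2 ∷ cs)))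
              (removeAt-ladder-last 3 3 (1 + k)) ⟩
    S (2 ∷ t) - (S (c ∷ t) - sgn (2 + k) * S (c ∷ 2 ∷ ladder 3 3 (1 + k)))
      ≡⟨ cong₂ _-_ (toBand _) (cong₂ _-_ (toBand _) (cong (sgn (2 + k) *_) (toBand _))) ⟩
    bandMinor 2 (2 ∷ t)
      - (bandMinor 2 (c ∷ t) - sgn (2 + k) * bandMinor 2 (c ∷ 2 ∷ ladder 3 3 (1 + k))) ∎
    where
    open ≡-Reasoning
    S : Vec ℕ (4 + k) → ℤ
    S = subdet ((Mₖ ∘ suc) ∘ suc)
    t : Vec ℕ (3 + k)
    t = ladder 3 3 (2 + k)

  row₁-expansion-gapped :
    subdet (Mₖ ∘ suc) (0 ∷ 1 ∷ 2 ∷ ladder 3 4 (1 + k))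
      ≡ bandMinor 2 (1 ∷ 2 ∷ ladder 3 4 (1 + k))
        - (bandMinor 2 (0 ∷ 2 ∷ ladder 3 4 (1 + k))
           - (bandMinor 2 (0 ∷ 1 ∷ ladder 3 4 (1 + k)) - sgn (1 + k) * 1ℤ))
  row₁-expansion-gapped = begin
    subdet (Mₖ ∘ suc) (0 ∷ 1 ∷ 2 ∷ t)
      ≡⟨ subdet-laplace (Mₖ ∘ suc) (0 ∷ 1 ∷ 2 ∷ t) ⟩
    cofactors (Mₖ ∘ suc) id (0 ∷ 1 ∷ 2 ∷ t)
      ≡⟨ cofactors-∷ {f = Mₖ ∘ suc} {cs = 2 ∷ t} {id} refl ⟩
    S (1 ∷ 2 ∷ t) - cofactors (Mₖ ∘ suc) (0 ∷_) (1 ∷ 2 ∷ t)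
      ≡⟨ cong (_-_ (S (1 ∷ 2 ∷ t))) (cofactors-∷ {f = Mₖ ∘ suc} {cs = t} {0 ∷_} refl) ⟩
    S (1 ∷ 2 ∷ t) - (S (0 ∷ 2 ∷ t) - cofactors (Mₖ ∘ suc) (λ v → 0 ∷ 1 ∷ v) (2 ∷ t))
      ≡⟨ cong (λ z → S (1 ∷ 2 ∷ t) - (S (0 ∷ 2 ∷ t) - z))
              (cofactors-∷ {f = Mₖ ∘ suc} {cs = ladder 4 5 k} {λ v → 0 ∷ 1 ∷ v} refl) ⟩
    S (1 ∷ 2 ∷ t)
      - (S (0 ∷ 2 ∷ t) - (S (0 ∷ 1 ∷ t) - cofactors (Mₖ ∘ suc) (λ v → 0 ∷ 1 ∷ 2 ∷ v) t))
      ≡⟨ cong (λ z → S (1 ∷ 2 ∷ t) - (S (0 ∷ 2 ∷ t) - (S (0 ∷ 1 ∷ t) - z)))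
              (cofactors-row₁ 4 (1 + k) {λ v → 0 ∷ 1 ∷ 2 ∷ v} refl (ℕ.n≤1+n (1 + k))) ⟩
    S (1 ∷ 2 ∷ t) - (S (0 ∷ 2 ∷ t) - (S (0 ∷ 1 ∷ t)
      - sgn (1 + k) * S (0 ∷ 1 ∷ 2 ∷ removeAt t (fromℕ (1 + k)))))
      ≡⟨ cong (λ cs → S (1 ∷ 2 ∷ t)
                         - (S (0 ∷ 2 ∷ t) - (S (0 ∷ 1 ∷ t) - sgn (1 + k) * S (0 ∷ 1 ∷ 2 ∷ cs))))
              (removeAt-ladder-last 3 4 k) ⟩
    S (1 ∷ 2 ∷ t)
      - (S (0 ∷ 2 ∷ t) - (S (0 ∷ 1 ∷ t) - sgn (1 + k) * S (0 ∷ 1 ∷ 2 ∷ ladder 3 3 k)))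
      ≡⟨ cong₂ _-_ (toBand _) (cong₂ _-_ (toBand _)
                              (cong₂ _-_ (toBand _) (cong (sgn (1 + k) *_) (toBand _)))) ⟩
    bandMinor 2 (1 ∷ 2 ∷ t) - (bandMinor 2 (0 ∷ 2 ∷ t)
      - (bandMinor 2 (0 ∷ 1 ∷ t) - sgn (1 + k) * bandMinor 2 (0 ∷ 1 ∷ 2 ∷ ladder 3 3 k)))
      ≡⟨ cong (λ w → bandMinor 2 (1 ∷ 2 ∷ t) - (bandMinor 2 (0 ∷ 2 ∷ t)
                       - (bandMinor 2 (0 ∷ 1 ∷ t) - sgn (1 + k) * w)))
              (unitriangularMinor k) ⟩
    bandMinor 2 (1 ∷ 2 ∷ t)
      - (bandMinor 2 (0 ∷ 2 ∷ t) - (bandMinor 2 (0 ∷ 1 ∷ t) - sgn (1 + k) * 1ℤ)) ∎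
    where
    open ≡-Reasoning
    S : Vec ℕ (4 + k) → ℤ
    S = subdet ((Mₖ ∘ suc) ∘ suc)
    t : Vec ℕ (2 + k)
    t = ladder 3 4 (1 + k)

det-expansion : ∀ k → det (6 + k) (Mmat (6 + k)) ≡ detFormula k
det-expansion k = begin
  det (6 + k) (Mmat (6 + k))
    ≡⟨ det-Mmat (6 + k) (ladder 0 0 (5 + k)) (lookup-ladder 0 (5 + k)) ⟩
  subdet (M (6 + k)) (ladder 0 0 (5 + k))
    ≡⟨ row₀-expansion k ⟩
  _ ≡⟨ cong₂ _-_ (row₁-expansion k 1 refl)
                 (cong₂ _-_ (row₁-expansion k 0 refl)
                            (cong (sgn (2 + k) *_) (row₁-expansion-gapped k))) ⟩
  detFormula k ∎
  where open ≡-Reasoning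

sgn-periodic : ∀ m → sgn (4 + m) ≡ sgn m
sgn-periodic m = trans (sgn-+2 (2 + m)) (sgn-+2 m)
  where
  sgn-+2 : ∀ m → sgn (2 + m) ≡ sgn m
  sgn-+2 m = trans (-1*i≡-i _) (trans (cong -_ (-1*i≡-i (sgn m))) (neg-involutive (sgn m)))

detFormula-periodic : ∀ k → detFormula (4 + k) ≡ detFormula k
detFormula-periodic k =
  trans (cong₂ (λ u v → topExpansion u v (pqr 5 (4 + k)) (sgn (5 + k)))
               (abc-periodic (1 + k)) (pqr₄-periodic k))
        (cong₂ (topExpansion (abc 4 (1 + k)) (pqr 4 k)) (pqr₅-periodic k) (sgn-periodic (1 + k)))
  where
  abc-periodic : ∀ p → abc 4 (4 + p) ≡ abc 4 p
  abc-periodic = recurrence-periodic abc-step (abc 4) (abc-suc ℕ.≤-refl) 4 abc-orbit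
  pqr₄-periodic : ∀ p → pqr 4 (4 + p) ≡ pqr 4 p
  pqr₄-periodic = recurrence-periodic pqr-step (pqr 4) (pqr-suc ℕ.≤-refl) 4 pqr₄-orbit
  pqr₅-periodic : ∀ p → pqr 5 (4 + p) ≡ pqr 5 p
  pqr₅-periodic = recurrence-periodic pqr-step (pqr 5) (pqr-suc (ℕ.n≤1+n 4)) 4 pqr₅-orbit

[4+m]%4≡m%4 : ∀ m → (4 + m) % 4 ≡ m % 4
[4+m]%4≡m%4 m = trans (cong (_% 4) (ℕ.+-comm 4 m)) ([m+n]%n≡m%n m 4)

detFormula-value : ∀ k → detFormula k ≡ residueValue ((6 + k) % 4)
detFormula-value 0 = detFormula-initial zero
detFormula-value 1 = detFormula-initial (suc zero)
detFormula-value 2 = detFormula-initial (suc (suc zero))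
detFormula-value 3 = detFormula-initial (suc (suc (suc zero)))
detFormula-value (suc (suc (suc (suc k)))) =
  trans (detFormula-periodic k)
        (trans (detFormula-value k) (cong residueValue (sym ([4+m]%4≡m%4 (6 + k)))))

det-Mmat-value : ∀ n → 4 ≤ n → det n (Mmat n) ≡ residueValue (n % 4)
det-Mmat-value 4 _ = refl
det-Mmat-value 5 _ = refl
det-Mmat-value n@(suc (suc (suc (suc (suc (suc k)))))) _ = from-6 n refl
  where
  -- Comparing det (suc (suc … k)) with det (6 + k) directly would unfold det.
  from-6 : ∀ n → n ≡ 6 + k → det n (Mmat n) ≡ residueValue (n % 4)
  from-6 _ refl = trans (det-expansion k) (detFormula-value k)
det-Mmat-value 0 ()
det-Mmat-value 1 (s≤s ())
det-Mmat-value 2 (s≤s (s≤s ()))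
det-Mmat-value 3 (s≤s (s≤s (s≤s ())))

theorem2 : (n : ℕ) → 4 ≤ n →
    ((n % 4 ≡ 0 → det n (Mmat n) ≡ + 0) ×
     (n % 4 ≡ 1 → det n (Mmat n) ≡ + 2) ×
     (n % 4 ≡ 2 → det n (Mmat n) ≡ + 3) ×
     (n % 4 ≡ 3 → det n (Mmat n) ≡ + 1))
theorem2 n 4≤n = at , at , at , at
  where
  at : ∀ {r} → n % 4 ≡ r → det n (Mmat n) ≡ residueValue r
  at n%4≡r = trans (det-Mmat-value n 4≤n) (cong residueValue n%4≡r)
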